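{- Let $\mathcal{A}$ be a unital associative algebra over a field of characteristic $0$, let $p,q\ge 1$, and let $M \in \operatorname{Mat}(\mathcal{A},p+q,p+q)$ be of the block form $M = \begin{pmatrix} A & 0 \\ B & D\end{pmatrix}$, where $A$ is $p\times p$, the upper-right block is the $p\times q$ zero matrix, $B$ is $q\times p$ and $D$ is $q \times q$. Let $M' = \begin{pmatrix} A & 0 \\ 0 & D\end{pmatrix}$ (the same matrix with $B$ replaced by the $q\times p$ zero matrix). Then $\mathsf{sdet}\, M = \mathsf{sdet}\, M'$.
   Context: For an $n\times n$ matrix $M=(m_{ij})$ with entries in an associative algebra $\mathcal{A}$ over a field of characteristic $0$, the symmetrized determinant is $\mathsf{sdet}\, M = \frac{1}{n!}\sum_{(\sigma,\tau)\in \mathsf{Sym}_n\times\mathsf{Sym}_n} (\operatorname{sgn}\sigma)(\operatorname{sgn}\tau)\, m_{\sigma(1)\tau(1)} m_{\sigma(2)\tau(2)}\cdots m_{\sigma(n)\tau(n)}$, where the products are taken in the indicated (left-to-right) order in $\mathcal{A}$ and $\mathsf{Sym}_n$ is the symmetric group on $[n]=\{1,\dots,n\}$. $\operatorname{Mat}(\mathcal{A},p,q)$ denotes the $p\times q$ matrices with entries in $\mathcal{A}$. -}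

module Defs where

open import Level using (Level; _⊔_) renaming (suc to lsuc)
open import Algebra.Bundles using (CommutativeRing; Ring)
open import Data.Nat using (ℕ; zero; suc; NonZero; _!)
import Data.Nat
open import Data.Nat.Properties using (_!≢0)
open import Data.Fin using (Fin; zero; suc; splitAt; _<?_; _≟_)
open import Data.Fin.Properties using (all?)
open import Data.Bool using (Bool; true; false; if_then_else_; not; _∧_)
open import Data.List using (List; []; _∷_; map; concatMap; filter; foldr; length)
open import Data.List.Base using (allFin)
open import Data.Product using (∃; _,_; proj₁; _×_)
open import Data.Sum using (inj₁; inj₂)
open import Data.Vec.Functional using (Vector) renaming (_∷_ to _∷ᶠ_)
open import Relation.Nullary using (¬_; Dec; yes; no; does)
open import Relation.Binary.PropositionalEquality using (_≡_; _≢_)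

record Field (c ℓ : Level) : Set (lsuc (c ⊔ ℓ)) where
  field
    commutativeRing : CommutativeRing c ℓ
  open CommutativeRing commutativeRing public
  field
    0≉1     : ¬ (0# ≈ 1#)
    inverse : ∀ x → ¬ (x ≈ 0#) → ∃ λ y → x * y ≈ 1#

module _ {c ℓ} (R : Ring c ℓ) where
  open Ring R using (Carrier; _+_; 0#; 1#)
  natCast : ℕ → Carrier
  natCast zero    = 0#
  natCast (suc n) = 1# + natCast n

CharacteristicZero : ∀ {c ℓ} → Field c ℓ → Set ℓ
CharacteristicZero K =
  ∀ n → NonZero n → ¬ (natCast (CommutativeRing.ring (Field.commutativeRing K)) n ≈ 0#)
  where open Field K

record Algebra {c ℓ} (K : Field c ℓ) (a ℓa : Level) : Set (c ⊔ ℓ ⊔ lsuc (a ⊔ ℓa)) where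
  private module K = Field K
  field
    ring : Ring a ℓa
  open Ring ring public
  field
    φ         : K.Carrier → Carrier
    φ-cong    : ∀ {x y} → x K.≈ y → φ x ≈ φ y
    φ-+       : ∀ x y → φ (x K.+ y) ≈ φ x + φ y
    φ-*       : ∀ x y → φ (x K.* y) ≈ φ x * φ y
    φ-1       : φ K.1# ≈ 1#
    φ-central : ∀ k x → φ k * x ≈ x * φ k

allFuns : ∀ n m → List (Fin n → Fin m)
allFuns zero    m = (λ ()) ∷ []
allFuns (suc n) m = concatMap (λ f → map (λ k → k ∷ᶠ f) (allFin m)) (allFuns n m)

isInjective? : ∀ {n m} (f : Fin n → Fin m) → Dec (∀ i j → f i ≡ f j → i ≡ j)
isInjective? {n} f = all? λ i → all? λ j → dec i j
  where
  dec : ∀ i j → Dec (f i ≡ f j → i ≡ j)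
  dec i j with f i ≟ f j | i ≟ j
  ... | _      | yes i≡j = yes (λ _ → i≡j)
  ... | no fi≢fj | no _  = yes (λ e → Data.Empty.⊥-elim (fi≢fj e))
    where import Data.Empty
  ... | yes fi≡fj | no i≢j = no (λ h → i≢j (h fi≡fj))

-- Sym_n as a list of the permutations of [n] (each exactly once)
Sym : ∀ n → List (Fin n → Fin n)
Sym n = filter isInjective? (allFuns n n)

inversions : ∀ {n} → (Fin n → Fin n) → ℕ
inversions {n} σ =
  length (Data.List.filterᵇ (λ ij → does (proj₁ ij <? Data.Product.proj₂ ij)
                           Data.Bool.∧ does (σ (Data.Product.proj₂ ij) <? σ (proj₁ ij)))
                 (concatMap (λ i → map (λ j → (i , j)) (allFin n)) (allFin n)))
  where import Data.Product; import Data.Bool; import Data.List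

isEven : ℕ → Bool
isEven zero    = true
isEven (suc n) = not (isEven n)

module _ {c ℓ a ℓa} {K : Field c ℓ} (ch0 : CharacteristicZero K)
         (𝒜 : Algebra K a ℓa) where
  private module K = Field K
  open Algebra 𝒜 using (Carrier; _+_; _*_; -_; 0#; 1#; φ)

  sgn : ∀ {n} → (Fin n → Fin n) → Carrier
  sgn σ = if isEven (inversions σ) then 1# else - 1#

  prodᶠ : ∀ {n} → (Fin n → Carrier) → Carrier
  prodᶠ {zero}  x = 1#
  prodᶠ {suc n} x = x zero * prodᶠ (λ i → x (suc i))

  sumL : ∀ {X : Set} → (X → Carrier) → List X → Carrier
  sumL f = foldr (λ x s → f x + s) 0#

  invFact : ℕ → K.Carrier
  invFact n = proj₁ (K.inverse (natCast K.ring (n !)) (ch0 (n !) (n !≢0)))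

  sdet : ∀ {n} → (Fin n → Fin n → Carrier) → Carrier
  sdet {n} M = φ (invFact n) *
    sumL (λ σ → sumL (λ τ → sgn σ * sgn τ * prodᶠ (λ i → M (σ i) (τ i))) (Sym n)) (Sym n)

  blockLower : ∀ p q → (Fin p → Fin p → Carrier) → (Fin q → Fin p → Carrier)
             → (Fin q → Fin q → Carrier) → Fin (p Data.Nat.+ q) → Fin (p Data.Nat.+ q) → Carrier
  blockLower p q A B D i j with splitAt p i | splitAt p j
  ... | inj₁ i′ | inj₁ j′ = A i′ j′
  ... | inj₁ i′ | inj₂ j′ = 0#
  ... | inj₂ i′ | inj₁ j′ = B i′ j′
  ... | inj₂ i′ | inj₂ j′ = D i′ j′

  zeroMat : ∀ q p → Fin q → Fin p → Carrier
  zeroMat q p _ _ = 0#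

{-# OPTIONS --safe #-}
-- In a product m_{σ1τ1} ⋯ m_{σnτn} with σ, τ permutations, either some factor lies in the
-- zero upper-right block, and the product vanishes for every B, or no index is sent by σ
-- to the top rows and by τ to the bottom columns.  In the latter case σ⁻¹(top) ⊆ τ⁻¹(top),
-- and both sets have p elements, so they coincide: no factor lies in the block B.
module Submission where

open import Defs
open import Data.Nat using (ℕ; _+_; _≤_)
import Data.Nat as ℕ
import Data.Nat.Properties as ℕ
open import Data.Fin using (Fin; zero; suc; splitAt; _↑ˡ_; punchOut)
open import Data.Fin.Properties
  using (_≟_; any?; punchOut-injective; injective⇒≤; ↑ˡ-injective; splitAt-↑ˡ; splitAt⁻¹-↑ˡ)
open import Data.Product using (∃; _,_; proj₁; proj₂)
open import Data.Sum using (inj₁; inj₂)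
open import Data.List using (List; []; _∷_)
open import Data.List.Relation.Unary.Any using (here; there)
open import Data.List.Membership.Propositional using (_∈_)
open import Data.List.Membership.Propositional.Properties using (∈-filter⁻)
open import Function using (_∘_; case_of_)
open import Function.Definitions using (Injective; StrictlySurjective)
open import Relation.Nullary using (¬_; yes; no; contradiction)
open import Relation.Nullary.Decidable using (decidable-stable; _×-dec_; ¬?)
open import Relation.Unary using (Decidable)
open import Relation.Binary.PropositionalEquality
  using (_≡_; _≢_; refl; sym; trans; cong; subst; module ≡-Reasoning)

injective⇒surjective : ∀ {n} {f : Fin n → Fin n} →
                       Injective _≡_ _≡_ f → StrictlySurjective _≡_ f
injective⇒surjective {ℕ.suc n} {f} f-inj k with any? (λ i → f i ≟ k)
... | yes found = found
... | no ¬found = contradiction (injective⇒≤ punchOut∘f-injective) ℕ.1+n≰n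
  where
  k≢f : ∀ i → k ≢ f i
  k≢f i k≡fi = ¬found (i , sym k≡fi)

  punchOut∘f-injective : Injective _≡_ _≡_ (λ i → punchOut (k≢f i))
  punchOut∘f-injective eq = f-inj (punchOut-injective (k≢f _) (k≢f _) eq)

Image : ∀ {m n} → (Fin m → Fin n) → Fin n → Set
Image ι k = ∃ λ j → ι j ≡ k

image? : ∀ {m n} (ι : Fin m → Fin n) → Decidable (Image ι)
image? ι k = any? (λ j → ι j ≟ k)

module _ {m n} {ι : Fin m → Fin n} (ι-inj : Injective _≡_ _≡_ ι) where

  -- If k were outside the image, k together with the image would be m + 1 points
  -- mapped injectively by π into the m-element image.
  injective-image-stable⇒preimage-⊆ : ∀ {π : Fin n → Fin n} → Injective _≡_ _≡_ π →
    (∀ j → Image ι (π (ι j))) → ∀ k → Image ι (π k) → Image ι k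
  injective-image-stable⇒preimage-⊆ {π} π-inj ι⇒πι k πk∈ =
    decidable-stable (image? ι k) λ k∉ → ℕ.1+n≰n (injective⇒≤ (h-injective k∉))
    where
    g : Fin (ℕ.suc m) → Fin n
    g zero    = k
    g (suc j) = ι j

    πg∈ : ∀ x → Image ι (π (g x))
    πg∈ zero    = πk∈
    πg∈ (suc j) = ι⇒πι j

    g-injective : ¬ Image ι k → Injective _≡_ _≡_ g
    g-injective k∉ {zero}  {zero}  _  = refl
    g-injective k∉ {zero}  {suc j} eq = contradiction (j , sym eq) k∉
    g-injective k∉ {suc j} {zero}  eq = contradiction (j , eq) k∉
    g-injective k∉ {suc i} {suc j} eq = cong suc (ι-inj eq)

    h-injective : ¬ Image ι k → Injective _≡_ _≡_ (λ x → proj₁ (πg∈ x))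
    h-injective k∉ {x} {y} eq = g-injective k∉ (π-inj (begin
      π (g x)             ≡⟨ sym (proj₂ (πg∈ x)) ⟩
      ι (proj₁ (πg∈ x))   ≡⟨ cong ι eq ⟩
      ι (proj₁ (πg∈ y))   ≡⟨ proj₂ (πg∈ y) ⟩
      π (g y)             ∎))
      where open ≡-Reasoning

  preimage-image-⊆⇒⊇ : ∀ {σ τ : Fin n → Fin n} →
    Injective _≡_ _≡_ σ → Injective _≡_ _≡_ τ →
    (∀ i → Image ι (σ i) → Image ι (τ i)) → ∀ i → Image ι (τ i) → Image ι (σ i)
  preimage-image-⊆⇒⊇ {σ} {τ} σ-inj τ-inj σ⊆τ i τi∈ =
    injective-image-stable⇒preimage-⊆ τσ⁻¹-injective ι⇒τσ⁻¹ι (σ i)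
      (subst (Image ι ∘ τ) (sym (σ⁻¹-σ i)) τi∈)
    where
    σ⁻¹ : Fin n → Fin n
    σ⁻¹ k = proj₁ (injective⇒surjective σ-inj k)

    σ-σ⁻¹ : ∀ k → σ (σ⁻¹ k) ≡ k
    σ-σ⁻¹ k = proj₂ (injective⇒surjective σ-inj k)

    σ⁻¹-σ : ∀ i → σ⁻¹ (σ i) ≡ i
    σ⁻¹-σ i = σ-inj (σ-σ⁻¹ (σ i))

    τσ⁻¹-injective : Injective _≡_ _≡_ (τ ∘ σ⁻¹)
    τσ⁻¹-injective {k} {l} eq = trans (sym (σ-σ⁻¹ k)) (trans (cong σ (τ-inj eq)) (σ-σ⁻¹ l))

    ι⇒τσ⁻¹ι : ∀ j → Image ι (τ (σ⁻¹ (ι j)))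
    ι⇒τσ⁻¹ι j = σ⊆τ (σ⁻¹ (ι j)) (j , sym (σ-σ⁻¹ (ι j)))

splitAt-inj₁⇒image-↑ˡ : ∀ {p q} {k : Fin (p + q)} {k′} → splitAt p k ≡ inj₁ k′ → Image (_↑ˡ q) k
splitAt-inj₁⇒image-↑ˡ eq = _ , splitAt⁻¹-↑ˡ eq

splitAt-inj₂⇒∉image-↑ˡ : ∀ {p q} {k : Fin (p + q)} {k′} → splitAt p k ≡ inj₂ k′ → ¬ Image (_↑ˡ q) k
splitAt-inj₂⇒∉image-↑ˡ {p} {q} eq (j , refl) = case trans (sym (splitAt-↑ˡ p j q)) eq of λ ()

module _ {c ℓ a ℓa} {K : Field c ℓ} (ch0 : CharacteristicZero K) (𝒜 : Algebra K a ℓa) where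
  open Algebra 𝒜 using (Carrier; _≈_; 0#; +-cong; *-cong; zeroˡ; zeroʳ)
  module 𝒜 = Algebra 𝒜

  prodᶠ-cong : ∀ {n} {x y : Fin n → Carrier} → (∀ i → x i ≈ y i) → prodᶠ ch0 𝒜 x ≈ prodᶠ ch0 𝒜 y
  prodᶠ-cong {ℕ.zero}  x≈y = 𝒜.refl
  prodᶠ-cong {ℕ.suc n} x≈y = *-cong (x≈y zero) (prodᶠ-cong (x≈y ∘ suc))

  prodᶠ-zero : ∀ {n} (x : Fin n → Carrier) i → x i ≈ 0# → prodᶠ ch0 𝒜 x ≈ 0#
  prodᶠ-zero x zero    xi≈0 = 𝒜.trans (*-cong xi≈0 𝒜.refl) (zeroˡ _)
  prodᶠ-zero x (suc i) xi≈0 = 𝒜.trans (*-cong 𝒜.refl (prodᶠ-zero (x ∘ suc) i xi≈0)) (zeroʳ _)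

  sumL-cong : ∀ {X : Set} {f g : X → Carrier} (xs : List X) →
              (∀ {x} → x ∈ xs → f x ≈ g x) → sumL ch0 𝒜 f xs ≈ sumL ch0 𝒜 g xs
  sumL-cong []       f≈g = 𝒜.refl
  sumL-cong (x ∷ xs) f≈g = +-cong (f≈g (here refl)) (sumL-cong xs (f≈g ∘ there))

  Sym-injective : ∀ {n} {σ : Fin n → Fin n} → σ ∈ Sym n → Injective _≡_ _≡_ σ
  Sym-injective {n} σ∈ = proj₂ (∈-filter⁻ isInjective? {xs = allFuns n n} σ∈) _ _

  sdet-cong : ∀ {n} (M N : Fin n → Fin n → Carrier) →
    (∀ {σ τ} → Injective _≡_ _≡_ σ → Injective _≡_ _≡_ τ →
       prodᶠ ch0 𝒜 (λ i → M (σ i) (τ i)) ≈ prodᶠ ch0 𝒜 (λ i → N (σ i) (τ i))) →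
    sdet ch0 𝒜 M ≈ sdet ch0 𝒜 N
  sdet-cong {n} M N M≈N = *-cong 𝒜.refl (sumL-cong (Sym n) λ σ∈ → sumL-cong (Sym n) λ τ∈ →
    *-cong 𝒜.refl (M≈N (Sym-injective σ∈) (Sym-injective τ∈)))

  module _ (p q : ℕ) (A : Fin p → Fin p → Carrier) (D : Fin q → Fin q → Carrier) where
    private
      Top : Fin (p + q) → Set
      Top = Image (_↑ˡ q)

    blockLower-upperRight≈0 : ∀ B {i j} → Top i → ¬ Top j → blockLower ch0 𝒜 p q A B D i j ≈ 0#
    blockLower-upperRight≈0 B {i} {j} i∈ j∉ with splitAt p i in ei | splitAt p j in ej
    ... | inj₁ _ | inj₁ _ = contradiction (splitAt-inj₁⇒image-↑ˡ ej) j∉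
    ... | inj₁ _ | inj₂ _ = 𝒜.refl
    ... | inj₂ _ | _      = contradiction i∈ (splitAt-inj₂⇒∉image-↑ˡ ei)

    blockLower-B-irrelevant : ∀ B B′ {i j} → (Top j → Top i) →
      blockLower ch0 𝒜 p q A B D i j ≡ blockLower ch0 𝒜 p q A B′ D i j
    blockLower-B-irrelevant B B′ {i} {j} j⇒i with splitAt p i in ei | splitAt p j in ej
    ... | inj₁ _ | inj₁ _ = refl
    ... | inj₁ _ | inj₂ _ = refl
    ... | inj₂ _ | inj₁ _ = contradiction (j⇒i (splitAt-inj₁⇒image-↑ˡ ej)) (splitAt-inj₂⇒∉image-↑ˡ ei)
    ... | inj₂ _ | inj₂ _ = refl

    blockLower-diagonal-B-irrelevant : ∀ B B′ {σ τ} →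
      Injective _≡_ _≡_ σ → Injective _≡_ _≡_ τ →
      prodᶠ ch0 𝒜 (λ i → blockLower ch0 𝒜 p q A B D (σ i) (τ i)) ≈
      prodᶠ ch0 𝒜 (λ i → blockLower ch0 𝒜 p q A B′ D (σ i) (τ i))
    blockLower-diagonal-B-irrelevant B B′ {σ} {τ} σ-inj τ-inj
      with any? (λ i → image? (_↑ˡ q) (σ i) ×-dec ¬? (image? (_↑ˡ q) (τ i)))
    ... | yes (i , σi∈ , τi∉) =
      𝒜.trans (prodᶠ-zero _ i (blockLower-upperRight≈0 B σi∈ τi∉))
              (𝒜.sym (prodᶠ-zero _ i (blockLower-upperRight≈0 B′ σi∈ τi∉)))
    ... | no ∄upperRight = prodᶠ-cong λ i →
      𝒜.reflexive (blockLower-B-irrelevant B B′ (preimage-image-⊆⇒⊇ ↑ˡ-inj σ-inj τ-inj σ⊆τ i))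
      where
      ↑ˡ-inj : Injective _≡_ _≡_ (_↑ˡ q)
      ↑ˡ-inj = ↑ˡ-injective q _ _

      σ⊆τ : ∀ i → Top (σ i) → Top (τ i)
      σ⊆τ i σi∈ = decidable-stable (image? (_↑ˡ q) (τ i)) λ τi∉ → ∄upperRight (i , σi∈ , τi∉)

    sdet-blockLower-B-irrelevant : ∀ B B′ →
      sdet ch0 𝒜 (blockLower ch0 𝒜 p q A B D) ≈ sdet ch0 𝒜 (blockLower ch0 𝒜 p q A B′ D)
    sdet-blockLower-B-irrelevant B B′ =
      sdet-cong (blockLower ch0 𝒜 p q A B D) (blockLower ch0 𝒜 p q A B′ D)
        (blockLower-diagonal-B-irrelevant B B′)

proposition2p1 :
    ∀ {c ℓ a ℓa} (K : Field c ℓ) (ch0 : CharacteristicZero K) (𝒜 : Algebra K a ℓa)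
      (p q : ℕ) → 1 ≤ p → 1 ≤ q →
      (A : Fin p → Fin p → Algebra.Carrier 𝒜) (B : Fin q → Fin p → Algebra.Carrier 𝒜)
      (D : Fin q → Fin q → Algebra.Carrier 𝒜) →
      Algebra._≈_ 𝒜 (sdet ch0 𝒜 (blockLower ch0 𝒜 p q A B D))
                    (sdet ch0 𝒜 (blockLower ch0 𝒜 p q A (zeroMat ch0 𝒜 q p) D))
proposition2p1 K ch0 𝒜 p q _ _ A B D =
  sdet-blockLower-B-irrelevant ch0 𝒜 p q A D B (zeroMat ch0 𝒜 q p)
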